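{- Let $M \subseteq \{\Pi A \rightarrow \Sigma A \ | \ \Pi, \Sigma \in \{\Diamond\}^{*}\}$ be a set of modal general path axioms. Every derivation in the shallow nested calculus $\textsf{SKT} - \{(\blacksquare), (\Diamond^{ - })\} + \textit{NestSt}(M)$ is translatable to a derivation in the labeled calculus $\mathsf{G3Kt} - \{(\blacksquare), (\Diamond^{ - })\} + \textit{LabSt}(M)$.
   Context: Tense formulae: $A ::= p \mid \overline{p} \mid A\wedge A \mid A\vee A \mid \Box A \mid \Diamond A \mid \blacksquare A \mid \Diamond^{ - }A$, with $\Diamond^{ - }$ the past diamond (dual of $\blacksquare$). Nested sequents: $X ::= \varepsilon \mid A \mid X,X \mid \circ\{X\} \mid \bullet\{X\}$. $\textsf{SKT}$ has rules $(\textsf{id})$ $X,p,\overline{p}$; $(\vee)$; $(\wedge)$; contraction; weakening; display rules $(\textsf{rf})$ from $X,\circ\{Y\}$ infer $\bullet\{X\},Y$ and $(\textsf{rp})$ from $X,\bullet\{Y\}$ infer $\circ\{X\},Y$; $(\blacksquare)$ from $X,\bullet\{A\}$ infer $X,\blacksquare A$; $(\Box)$ from $X,\circ\{A\}$ infer $X,\Box A$; $(\Diamond^{ - })$ from $X,\bullet\{Y,A\},\Diamond^{ - }A$ infer $X,\bullet\{Y\},\Diamond^{ - }A$; $(\Diamond)$ from $X,\circ\{Y,A\},\Diamond A$ infer $X,\circ\{Y\},\Diamond A$. For an axiom $\langle ? \rangle_1\cdots\langle ? \rangle_n A\rightarrow\langle ? \rangle_{n+1}\cdots\langle ? \rangle_{n+m}A$,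 $\textit{NestSt}$ gives the rule: from $X, \star_{n+1} \{ \cdots \star_{n+m} \{ Y \} \cdots \}$ infer $X, \star_{1} \{ \cdots \star_{n} \{ Y \} \cdots \}$ ($\star=\circ$ for $\Diamond$, $\bullet$ for $\Diamond^{ - }$). Labeled sequents $\mathcal{R},\Gamma$ with relational atoms $Rxy$ and labeled formulae $x:A$. $\mathsf{G3Kt}$ has $(\textsf{id})$, $(\vee)$, $(\wedge)$, $(\Box)$ from $\mathcal{R},Rxy,y:A,\Gamma$ infer $\mathcal{R},x:\Box A,\Gamma$ ($y$ fresh), $(\Diamond)$ from $\mathcal{R},Rxy,y:A,x:\Diamond A,\Gamma$ infer $\mathcal{R},Rxy,x:\Diamond A,\Gamma$, $(\blacksquare)$ from $\mathcal{R},Ryx,y:A,\Gamma$ infer $\mathcal{R},x:\blacksquare A,\Gamma$ ($y$ fresh), $(\Diamond^{ - })$ from $\mathcal{R},Ryx,y:A,x:\Diamond^{ - }A,\Gamma$ infer $\mathcal{R},Ryx,x:\Diamond^{ - }A,\Gamma$. $\textit{LabSt}$ gives for $\Pi A\rightarrow\Sigma A$ the rule: from $\mathcal{R},\mathcal{R}_{\Pi}xy,\mathcal{R}_{\Sigma}xy,\Gamma$ infer $\mathcal{R},\mathcal{R}_{\Pi}xy,\Gamma$ (intermediate labels of $\mathcal{R}_\Sigma xy$ fresh), where $\mathcal{R}_\Pi xy$ is the chain of atoms from $x$ to $y$ along $\Pi$. The translation maps a nested sequent to a labeled sequent by reading $\circ$-nestings as forward atoms $Rxy$ and $\bullet$-nestings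 as backward atoms $Ryx$; display rules become trivial. This follows from the general translation from $\textsf{SKT}+\textit{NestSt(GP)}$ to $\mathsf{G3Kt}+\textit{LabSt(GP)}$ for general path axioms. -}

module Defs where

open import Data.Nat using (ℕ; zero; suc)
open import Data.Nat.Properties using (_≟_)
open import Data.Product using (_×_; _,_; proj₁; proj₂)
open import Data.List using (List; []; _∷_; _++_; map; concatMap)
open import Data.List.Membership.Propositional using (_∈_; _∉_)
open import Data.List.Relation.Unary.All using (All)
open import Data.List.Relation.Unary.Unique.Propositional using (Unique)
open import Data.List.Relation.Binary.Permutation.Propositional using (_↭_)
open import Relation.Binary.PropositionalEquality using (_≡_; _≢_)
open import Relation.Nullary using (yes; no)

-- Tense formulae in negation normal form (propositional variables are ℕ)

data Fm : Set where
  var  : ℕ → Fm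
  nvar : ℕ → Fm
  _∧_  : Fm → Fm → Fm
  _∨_  : Fm → Fm → Fm
  □    : Fm → Fm
  ◇    : Fm → Fm
  ■    : Fm → Fm
  ◇⁻   : Fm → Fm

-- A nested sequent is a (multi)set of items, given as
-- a list; top-level order is irrelevant thanks to the exchange rule.
--   fm A  : formula A
--   wh X  : ∘{X}
--   bl X  : •{X}

data Item : Set where
  fm : Fm → Item
  wh : List Item → Item
  bl : List Item → Item

NSeq : Set
NSeq = List Item

nestW : ℕ → NSeq → NSeq
nestW zero    Y = Y
nestW (suc k) Y = wh (nestW k Y) ∷ []

-- A set M of modal general path axioms ◇ⁿ A → ◇ᵐ A is a predicate on
-- pairs (n , m).
PathAxioms : Set₁
PathAxioms = ℕ → ℕ → Set

data NDer (M : PathAxioms) : NSeq → Set where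
  id   : ∀ {X p} → NDer M (fm (var p) ∷ fm (nvar p) ∷ X)
  ∨r   : ∀ {X A B} → NDer M (fm A ∷ fm B ∷ X) → NDer M (fm (A ∨ B) ∷ X)
  ∧r   : ∀ {X A B} → NDer M (fm A ∷ X) → NDer M (fm B ∷ X) → NDer M (fm (A ∧ B) ∷ X)
  ctr  : ∀ {X Y} → NDer M (Y ++ Y ++ X) → NDer M (Y ++ X)
  wk   : ∀ {X Y} → NDer M X → NDer M (Y ++ X)
  rf   : ∀ {X Y} → NDer M (wh Y ∷ X) → NDer M (bl X ∷ Y)
  rp   : ∀ {X Y} → NDer M (bl Y ∷ X) → NDer M (wh X ∷ Y)
  □r   : ∀ {X A} → NDer M (wh (fm A ∷ []) ∷ X) → NDer M (fm (□ A) ∷ X)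
  ◇r   : ∀ {X Y A} → NDer M (wh (fm A ∷ Y) ∷ fm (◇ A) ∷ X)
                  → NDer M (wh Y ∷ fm (◇ A) ∷ X)
  nest : ∀ {X Y n m} → M n m → NDer M (nestW m Y ++ X) → NDer M (nestW n Y ++ X)
  -- nested sequents are multisets: exchange at the top level
  exch : ∀ {X X'} → X ↭ X' → NDer M X → NDer M X'

Label : Set
Label = ℕ

Rel : Set
Rel = Label × Label            -- (x , y) stands for Rxy

LFm : Set
LFm = Label × Fm               -- (x , A) stands for x : A

labelsR : List Rel → List Label
labelsR = concatMap (λ r → proj₁ r ∷ proj₂ r ∷ [])

labelsΓ : List LFm → List Label
labelsΓ = map proj₁

labels : List Rel → List LFm → List Label
labels R Γ = labelsR R ++ labelsΓ Γ

-- R_Π x y for Π = ◇ⁿ : a chain of n forward atoms from x to y in R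
-- (for n = 0 this means x ≡ y)
data Path (R : List Rel) : ℕ → Label → Label → Set where
  here  : ∀ {x} → Path R zero x x
  there : ∀ {n x y z} → (x , y) ∈ R → Path R n y z → Path R (suc n) x z

chain : Label → List Label → Label → List Rel
chain x []       y = (x , y) ∷ []
chain x (w ∷ ws) y = (x , w) ∷ chain w ws y

-- renaming label y to x (used for R_ε x y, i.e. x = y)
ren : Label → Label → Label → Label
ren y x z with z ≟ y
... | yes _ = x
... | no  _ = z

renR : Label → Label → List Rel → List Rel
renR y x = map (λ r → ren y x (proj₁ r) , ren y x (proj₂ r))

renΓ : Label → Label → List LFm → List LFm
renΓ y x = map (λ a → ren y x (proj₁ a) , proj₂ a)

data Length {A : Set} : List A → ℕ → Set where
  []  : Length [] zero
  _∷_ : ∀ {xs n} (a : A) → Length xs n → Length (a ∷ xs) (suc n)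

data LDer (M : PathAxioms) : List Rel → List LFm → Set where
  id    : ∀ {R Γ x p} → LDer M R ((x , var p) ∷ (x , nvar p) ∷ Γ)
  ∨r    : ∀ {R Γ x A B} → LDer M R ((x , A) ∷ (x , B) ∷ Γ)
        → LDer M R ((x , A ∨ B) ∷ Γ)
  ∧r    : ∀ {R Γ x A B} → LDer M R ((x , A) ∷ Γ) → LDer M R ((x , B) ∷ Γ)
        → LDer M R ((x , A ∧ B) ∷ Γ)
  □r    : ∀ {R Γ x y A} → y ∉ labels R ((x , □ A) ∷ Γ)
        → LDer M ((x , y) ∷ R) ((y , A) ∷ Γ)
        → LDer M R ((x , □ A) ∷ Γ)
  ◇r    : ∀ {R Γ x y A} → (x , y) ∈ R
        → LDer M R ((y , A) ∷ (x , ◇ A) ∷ Γ)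
        → LDer M R ((x , ◇ A) ∷ Γ)
  -- LabSt for ◇ⁿ A → ◇^(suc m) A : add R_Σ x y with fresh intermediates ws
  labSt : ∀ {R Γ n m x y} (ws : List Label) → M n (suc m) → Path R n x y
        → Length ws m → Unique ws
        → All (λ w → w ∉ (x ∷ y ∷ labels R Γ)) ws
        → LDer M (chain x ws y ++ R) Γ
        → LDer M R Γ
  -- LabSt for ◇ⁿ A → A : R_ε x y is the identity x = y, realised by
  -- identifying the label y with x in the premise
  labSt₀ : ∀ {R Γ n x y} → M n zero → Path R n x y
         → LDer M (renR y x R) (renΓ y x Γ)
         → LDer M R Γ
  -- labelled sequents are multisets: exchange
  exch  : ∀ {R R' Γ Γ'} → R ↭ R' → Γ ↭ Γ' → LDer M R Γ → LDer M R' Γ'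

-- Translation of nested sequents into labelled sequents.
-- tr x k X : translate X rooted at label x, using fresh labels from k on;
-- returns (R , Γ , next unused label).  ∘ gives Rxy, • gives Ryx.

record LSeq : Set where
  constructor ⟨_,_,_⟩
  field
    rels : List Rel
    fms  : List LFm
    next : ℕ

mutual
  trItem : Label → ℕ → Item → LSeq
  trItem x k (fm A) = ⟨ [] , (x , A) ∷ [] , k ⟩
  trItem x k (wh Y) with trSeq k (suc k) Y
  ... | ⟨ R , Γ , k' ⟩ = ⟨ (x , k) ∷ R , Γ , k' ⟩
  trItem x k (bl Y) with trSeq k (suc k) Y
  ... | ⟨ R , Γ , k' ⟩ = ⟨ (k , x) ∷ R , Γ , k' ⟩

  trSeq : Label → ℕ → NSeq → LSeq
  trSeq x k [] = ⟨ [] , [] , k ⟩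
  trSeq x k (i ∷ X) with trItem x k i
  ... | ⟨ R₁ , Γ₁ , k₁ ⟩ with trSeq x k₁ X
  ... | ⟨ R₂ , Γ₂ , k₂ ⟩ = ⟨ R₁ ++ R₂ , Γ₁ ++ Γ₂ , k₂ ⟩

L : NSeq → LSeq
L X = trSeq 0 1 X

-- A nested derivation of X is turned into a labelled derivation of every labelled
-- sequent R , Γ in which X is realised at some label x: the tree of X maps into R , Γ
-- with root x, ∘-children along forward atoms, •-children along backward atoms and
-- formulas onto labelled formulas.  Under this invariant the display rules only move
-- the root, weakening and contraction of nested sequents are immediate, and NestSt(M)
-- becomes LabSt(M) along the path realising its premise.  The realising map need not be
-- injective, so a logical rule may decompose a formula whose image is still needed
-- elsewhere; this is repaired by height-preserving admissibility of contraction in the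
-- labelled calculus, obtained as usual from height-preserving relabelling and the
-- invertibility of ∧, ∨ and □.  Finally L X realises X at the root label 0.

module Submission where

open import Defs
open import Data.Nat using (ℕ; zero; suc; _+_; _⊔_; _≤_; _<_; s≤s)
open import Data.Nat.Properties using (_≟_; ≤-refl; ≤-trans; ≤-pred; n≤1+n; m≤m+n; m≤n+m; m≤m⊔n; m≤n⊔m; 1+n≰n)
open import Data.List.Extrema.Nat using (max; xs≤max)
open import Data.Product using (∃; _×_; _,_; proj₁; proj₂; map₂)
open import Data.Sum using (_⊎_; inj₁; inj₂)
open import Data.Empty using (⊥-elim)
open import Function using (_∘_)
open import Data.List using (List; []; _∷_; _++_; map)
open import Data.List.Properties using (map-id; map-cong-local)
open import Data.List.Membership.Propositional using (_∈_; _∉_)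
open import Data.List.Membership.Propositional.Properties using (∈-∃++; ∈-++⁺ˡ; ∈-++⁺ʳ; ∈-++⁻; ∈-map⁺; ∈-map⁻)
open import Data.List.Relation.Binary.Subset.Propositional using (_⊆_)
open import Data.List.Relation.Unary.Any using (here; there)
open import Data.List.Relation.Unary.All as All using (All; []; _∷_)
open import Data.List.Relation.Unary.All.Properties using (¬Any⇒All¬; All¬⇒¬Any) renaming (map⁺ to All-map⁺; map⁻ to All-map⁻; ++⁺ to All-++⁺; ++⁻ to All-++⁻; ++⁻ˡ to All-++⁻ˡ; ++⁻ʳ to All-++⁻ʳ)
open import Data.List.Relation.Unary.AllPairs using ([]; _∷_)
open import Data.List.Relation.Unary.Unique.Propositional using (Unique)
open import Data.List.Relation.Binary.Permutation.Propositional using (_↭_; ↭-refl; ↭-sym; ↭-trans; prep; swap)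
open import Data.List.Relation.Binary.Permutation.Propositional.Properties using (∈-resp-↭; All-resp-↭; drop-∷; shift; shifts; ++⁺ˡ; map⁺)
open import Relation.Binary.PropositionalEquality using (_≡_; _≢_; refl; sym; trans; cong; cong₂; subst)
open import Relation.Nullary using (yes; no)

module _ {A : Set} where

  ∈⇒↭ : ∀ {a : A} {xs} → a ∈ xs → ∃ λ ys → xs ↭ a ∷ ys
  ∈⇒↭ a∈xs with ys , zs , refl ← ∈-∃++ a∈xs = ys ++ zs , shift _ ys zs

  ∈-↭-tail : ∀ {a b : A} {xs ys} → xs ↭ b ∷ ys → a ∈ xs → a ≢ b → a ∈ ys
  ∈-↭-tail p a∈xs a≢b with ∈-resp-↭ p a∈xs
  ... | here a≡b = ⊥-elim (a≢b a≡b)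
  ... | there a∈ys = a∈ys

  ∷-↭-∷⁻ : ∀ {a b : A} {xs ys} → a ∷ xs ↭ b ∷ ys →
           (a ≡ b × xs ↭ ys) ⊎ ∃ λ zs → xs ↭ b ∷ zs × ys ↭ a ∷ zs
  ∷-↭-∷⁻ {a} {b} p with ∈-resp-↭ (↭-sym p) (here refl)
  ... | here refl = inj₁ (refl , drop-∷ p)
  ... | there b∈xs with zs , q ← ∈⇒↭ b∈xs =
    inj₂ (zs , q , drop-∷ (↭-trans (↭-sym p) (↭-trans (prep a q) (swap a b ↭-refl))))

  ∷-↭-∷∷⁻ : ∀ {a b : A} {xs ys} → a ∷ xs ↭ b ∷ b ∷ ys →
            (a ≡ b × xs ↭ b ∷ ys) ⊎ ∃ λ zs → xs ↭ b ∷ b ∷ zs × ys ↭ a ∷ zs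
  ∷-↭-∷∷⁻ p with ∷-↭-∷⁻ p
  ... | inj₁ a≡b = inj₁ a≡b
  ... | inj₂ (zs₁ , q , r) with ∷-↭-∷⁻ (↭-sym r)
  ...   | inj₁ (refl , s) = inj₁ (refl , ↭-trans q (prep _ s))
  ...   | inj₂ (zs₂ , s , t) = inj₂ (zs₂ , ↭-trans q (prep _ s) , t)

  ↭-under : ∀ Θ Ψ {Γ Δ : List A} → Γ ↭ Ψ ++ Δ → Θ ++ Γ ↭ Ψ ++ Θ ++ Δ
  ↭-under Θ Ψ q = ↭-trans (++⁺ˡ Θ q) (shifts Θ Ψ)

  ↭-restore : ∀ Φ {a : A} {Δ Δ'} → Δ ↭ a ∷ Δ' → a ∷ Φ ++ Δ' ↭ Φ ++ Δ
  ↭-restore Φ {a} r = ↭-trans (↭-sym (shifts Φ (a ∷ []))) (++⁺ˡ Φ (↭-sym r))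

  ∈-dedup : ∀ {a b : A} {xs} → a ∈ b ∷ b ∷ xs → a ∈ b ∷ xs
  ∈-dedup (here a≡b) = here a≡b
  ∈-dedup (there a∈) = a∈

-- Fresh labels

fresh : (L : List ℕ) → ∃ λ n → n ∉ L
fresh L = suc (max 0 L) , λ n∈L → 1+n≰n (All.lookup (xs≤max 0 L) n∈L)

freshDistinct : ∀ m (L : List ℕ) → ∃ λ ws → Length ws m × Unique ws × All (_∉ L) ws
freshDistinct zero L = [] , [] , [] , []
freshDistinct (suc m) L =
  let ws , len , uniq , ws∉L = freshDistinct m L
      w , w∉ = fresh (ws ++ L)
  in w ∷ ws , w ∷ len , ¬Any⇒All¬ ws (w∉ ∘ ∈-++⁺ˡ) ∷ uniq , (w∉ ∘ ∈-++⁺ʳ ws) ∷ ws∉L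

FreshR : Label → List Rel → Set
FreshR y = All (λ r → y ≢ proj₁ r × y ≢ proj₂ r)

FreshΓ : Label → List LFm → Set
FreshΓ y = All (λ a → y ≢ proj₁ a)

Fresh : Label → List Rel → List LFm → Set
Fresh y R Γ = FreshR y R × FreshΓ y Γ

∉labels⇒Fresh : ∀ {y} R Γ → y ∉ labels R Γ → Fresh y R Γ
∉labels⇒Fresh [] Γ y∉ = [] , All-map⁻ (¬Any⇒All¬ _ y∉)
∉labels⇒Fresh (r ∷ R) Γ y∉ =
  let freshR , freshΓ = ∉labels⇒Fresh R Γ (λ y∈ → y∉ (there (there y∈)))
  in ((λ y≡u → y∉ (here y≡u)) , (λ y≡v → y∉ (there (here y≡v)))) ∷ freshR , freshΓ

Fresh⇒∉labels : ∀ {y} R Γ → Fresh y R Γ → y ∉ labels R Γ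
Fresh⇒∉labels [] Γ ([] , freshΓ) = All¬⇒¬Any (All-map⁺ freshΓ)
Fresh⇒∉labels (r ∷ R) Γ ((y≢u , _) ∷ _ , _) (here y≡u) = y≢u y≡u
Fresh⇒∉labels (r ∷ R) Γ ((_ , y≢v) ∷ _ , _) (there (here y≡v)) = y≢v y≡v
Fresh⇒∉labels (r ∷ R) Γ (_ ∷ freshR , freshΓ) (there (there y∈)) = Fresh⇒∉labels R Γ (freshR , freshΓ) y∈

freshFor : ∀ (L : List Label) R Γ → ∃ λ y → y ∉ L × Fresh y R Γ
freshFor L R Γ =
  let y , y∉ = fresh (L ++ labels R Γ)
  in y , y∉ ∘ ∈-++⁺ˡ , ∉labels⇒Fresh R Γ (y∉ ∘ ∈-++⁺ʳ L)

FreshΓ-uncons : ∀ {w Γ x A Δ} → Γ ↭ (x , A) ∷ Δ → FreshΓ w Γ → w ≢ x × FreshΓ w Δ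
FreshΓ-uncons q fresh with w≢x ∷ freshΔ ← All-resp-↭ q fresh = w≢x , freshΔ

FreshR-chain : ∀ {w} x ws y → FreshR w (chain x ws y) → All (w ≢_) ws
FreshR-chain x [] y _ = []
FreshR-chain x (v ∷ ws) y ((_ , w≢v) ∷ fresh) = w≢v ∷ FreshR-chain v ws y fresh

FreshΓ-∨ : ∀ {w Γ x A B Δ} → Γ ↭ (x , A ∨ B) ∷ Δ → FreshΓ w Γ → FreshΓ w ((x , A) ∷ (x , B) ∷ Δ)
FreshΓ-∨ q fresh with w≢x ∷ freshΔ ← All-resp-↭ q fresh = w≢x ∷ w≢x ∷ freshΔ

FreshΓ-replace : ∀ {w Γ x A B Δ} → Γ ↭ (x , A) ∷ Δ → FreshΓ w Γ → FreshΓ w ((x , B) ∷ Δ)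
FreshΓ-replace q fresh with w≢x ∷ freshΔ ← All-resp-↭ q fresh = w≢x ∷ freshΔ

-- Relabelling

relabelΓ : (Label → Label) → List LFm → List LFm
relabelΓ σ = map (λ a → σ (proj₁ a) , proj₂ a)

Maps : (Label → Label) → List Rel → List Rel → Set
Maps σ R R' = ∀ {u v} → (u , v) ∈ R → (σ u , σ v) ∈ R'

Path-map : ∀ {σ R R' n x y} → Maps σ R R' → Path R n x y → Path R' n (σ x) (σ y)
Path-map inc here = here
Path-map inc (there xy∈R p) = there (inc xy∈R) (Path-map inc p)

Path-weaken : ∀ {r R n x y} → Path R n x y → Path (r ∷ R) n x y
Path-weaken = Path-map {σ = λ z → z} there

chain-map : ∀ σ x ws y → Maps σ (chain x ws y) (chain (σ x) (map σ ws) (σ y))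
chain-map σ x [] y (here refl) = here refl
chain-map σ x (w ∷ ws) y (here refl) = here refl
chain-map σ x (w ∷ ws) y (there uv∈) = there (chain-map σ w ws y uv∈)

update : Label → Label → (Label → Label) → Label → Label
update y y' σ z with z ≟ y
... | yes _ = y'
... | no  _ = σ z

update-same : ∀ y y' σ → update y y' σ y ≡ y'
update-same y y' σ with y ≟ y
... | yes _ = refl
... | no y≢y = ⊥-elim (y≢y refl)

update-other : ∀ {y z} y' σ → y ≢ z → update y y' σ z ≡ σ z
update-other {y} {z} y' σ y≢z with z ≟ y
... | yes z≡y = ⊥-elim (y≢z (sym z≡y))
... | no  _ = refl

updates : List Label → List Label → (Label → Label) → Label → Label
updates (w ∷ ws) (w' ∷ ws') σ = update w w' (updates ws ws' σ)
updates _ _ σ = σ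

updates-other : ∀ {z} ws ws' σ → All (_≢ z) ws → updates ws ws' σ z ≡ σ z
updates-other [] ws' σ _ = refl
updates-other (w ∷ ws) [] σ _ = refl
updates-other (w ∷ ws) (w' ∷ ws') σ (w≢z ∷ ws≢z) =
  trans (update-other w' _ w≢z) (updates-other ws ws' σ ws≢z)

map-updates : ∀ {m} ws ws' σ → Unique ws → Length ws m → Length ws' m → map (updates ws ws' σ) ws ≡ ws'
map-updates [] [] σ _ _ _ = refl
map-updates [] (_ ∷ _) σ _ [] ()
map-updates (w ∷ ws) (w' ∷ ws') σ (w≢ws ∷ uniq) (_ ∷ len) (_ ∷ len') =
  cong₂ _∷_ (update-same w w' _)
    (trans (map-cong-local (All.map (update-other w' _) w≢ws)) (map-updates ws ws' σ uniq len len'))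

Maps-updates : ∀ ws ws' {σ R R'} → All (λ w → FreshR w R) ws → Maps σ R R' → Maps (updates ws ws' σ) R R'
Maps-updates ws ws' {σ} {R' = R'} fresh inc uv∈ =
  subst (_∈ R')
    (sym (cong₂ _,_ (updates-other ws ws' σ (All.map (λ f → proj₁ (All.lookup f uv∈)) fresh))
                    (updates-other ws ws' σ (All.map (λ f → proj₂ (All.lookup f uv∈)) fresh))))
    (inc uv∈)

relabelΓ-updates : ∀ ws ws' {σ Γ} → All (λ w → FreshΓ w Γ) ws
                 → relabelΓ (updates ws ws' σ) Γ ≡ relabelΓ σ Γ
relabelΓ-updates ws ws' {σ} fresh =
  map-cong-local (All.tabulate λ a∈ → cong (_, _) (updates-other ws ws' σ (All.map (λ f → All.lookup f a∈) fresh)))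

ren-same : ∀ y x → ren y x y ≡ x
ren-same y x with y ≟ y
... | yes _ = refl
... | no y≢y = ⊥-elim (y≢y refl)

ren-other : ∀ {y z} x → y ≢ z → ren y x z ≡ z
ren-other {y} {z} x y≢z with z ≟ y
... | yes z≡y = ⊥-elim (y≢z (sym z≡y))
... | no  _ = refl

ren-target : ∀ y x → ren y x x ≡ x
ren-target y x with x ≟ y
... | yes _ = refl
... | no  _ = refl

≢-ren⁻ : ∀ {y y₀ x₀ a} → y ≢ y₀ → y ≢ ren y₀ x₀ a → y ≢ a
≢-ren⁻ {y₀ = y₀} {x₀} {a} y≢y₀ y≢ren with a ≟ y₀
... | yes refl = y≢y₀
... | no  _ = y≢ren

ren-relabel : ∀ (σ : Label → Label) y x a → ren (σ y) (σ x) (σ (ren y x a)) ≡ ren (σ y) (σ x) (σ a)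
ren-relabel σ y x a with a ≟ y
... | yes refl = trans (ren-target (σ a) (σ x)) (sym (ren-same (σ a) (σ x)))
... | no  _ = refl

renΓ-relabel : ∀ (σ : Label → Label) y x Γ
             → relabelΓ (λ z → ren (σ y) (σ x) (σ z)) (renΓ y x Γ) ≡ renΓ (σ y) (σ x) (relabelΓ σ Γ)
renΓ-relabel σ y x [] = refl
renΓ-relabel σ y x (a ∷ Γ) =
  cong₂ _∷_ (cong (_, proj₂ a) (ren-relabel σ y x (proj₁ a))) (renΓ-relabel σ y x Γ)

-- Height-preserving admissible rules

size : Fm → ℕ
size (var _) = zero
size (nvar _) = zero
size (A ∧ B) = suc (size A + size B)
size (A ∨ B) = suc (size A + size B)
size (□ A) = suc (size A)
size (◇ A) = suc (size A)
size (■ A) = suc (size A)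
size (◇⁻ A) = suc (size A)

<-suc-+ˡ : ∀ {a b k} → suc (a + b) < suc k → a < k
<-suc-+ˡ {a} {b} lt = ≤-trans (s≤s (m≤m+n a b)) (≤-pred lt)

<-suc-+ʳ : ∀ {a b k} → suc (a + b) < suc k → b < k
<-suc-+ʳ {a} {b} lt = ≤-trans (s≤s (m≤n+m b a)) (≤-pred lt)

-- LDer with a bound on the height; `Fresh w ((x , y) ∷ R) Γ` is the pointwise form of
-- LDer's side condition `w ∉ x ∷ y ∷ labels R Γ`.
data LDerʰ (M : PathAxioms) : ℕ → List Rel → List LFm → Set where
  id     : ∀ {h R Γ x p} → LDerʰ M h R ((x , var p) ∷ (x , nvar p) ∷ Γ)
  ∨r     : ∀ {h R Γ x A B} → LDerʰ M h R ((x , A) ∷ (x , B) ∷ Γ) → LDerʰ M (suc h) R ((x , A ∨ B) ∷ Γ)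
  ∧r     : ∀ {h R Γ x A B} → LDerʰ M h R ((x , A) ∷ Γ) → LDerʰ M h R ((x , B) ∷ Γ)
         → LDerʰ M (suc h) R ((x , A ∧ B) ∷ Γ)
  □r     : ∀ {h R Γ x y A} → Fresh y R ((x , □ A) ∷ Γ) → LDerʰ M h ((x , y) ∷ R) ((y , A) ∷ Γ)
         → LDerʰ M (suc h) R ((x , □ A) ∷ Γ)
  ◇r     : ∀ {h R Γ x y A} → (x , y) ∈ R → LDerʰ M h R ((y , A) ∷ (x , ◇ A) ∷ Γ)
         → LDerʰ M (suc h) R ((x , ◇ A) ∷ Γ)
  labSt  : ∀ {h R Γ n m x y} (ws : List Label) → M n (suc m) → Path R n x y
         → Length ws m → Unique ws → All (λ w → Fresh w ((x , y) ∷ R) Γ) ws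
         → LDerʰ M h (chain x ws y ++ R) Γ → LDerʰ M (suc h) R Γ
  labSt₀ : ∀ {h R Γ n x y} → M n zero → Path R n x y
         → LDerʰ M h (renR y x R) (renΓ y x Γ) → LDerʰ M (suc h) R Γ
  exch   : ∀ {h R R' Γ Γ'} → R ↭ R' → Γ ↭ Γ' → LDerʰ M h R Γ → LDerʰ M h R' Γ'

module _ {M : PathAxioms} where

  exchΓ : ∀ {h R Γ Γ'} → Γ ↭ Γ' → LDerʰ M h R Γ → LDerʰ M h R Γ'
  exchΓ = exch ↭-refl

  raise : ∀ {h h' R Γ} → h ≤ h' → LDerʰ M h R Γ → LDerʰ M h' R Γ
  raise _ id = id
  raise (s≤s h≤h') (∨r d) = ∨r (raise h≤h' d)
  raise (s≤s h≤h') (∧r d e) = ∧r (raise h≤h' d) (raise h≤h' e)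
  raise (s≤s h≤h') (□r fresh d) = □r fresh (raise h≤h' d)
  raise (s≤s h≤h') (◇r xy∈R d) = ◇r xy∈R (raise h≤h' d)
  raise (s≤s h≤h') (labSt ws ax p len uniq fresh d) = labSt ws ax p len uniq fresh (raise h≤h' d)
  raise (s≤s h≤h') (labSt₀ ax p d) = labSt₀ ax p (raise h≤h' d)
  raise h≤h' (exch p q d) = exch p q (raise h≤h' d)

  toʰ : ∀ {R Γ} → LDer M R Γ → ∃ λ h → LDerʰ M h R Γ
  toʰ id = zero , id
  toʰ (∨r d) = let h , dʰ = toʰ d in suc h , ∨r dʰ
  toʰ (∧r d e) =
    let h₁ , dʰ = toʰ d
        h₂ , eʰ = toʰ e
    in suc (h₁ ⊔ h₂) , ∧r (raise (m≤m⊔n h₁ h₂) dʰ) (raise (m≤n⊔m h₁ h₂) eʰ)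
  toʰ (□r {R = R} {Γ} {x} {A = A} y∉ d) =
    let h , dʰ = toʰ d in suc h , □r (∉labels⇒Fresh R ((x , □ A) ∷ Γ) y∉) dʰ
  toʰ (◇r xy∈R d) = let h , dʰ = toʰ d in suc h , ◇r xy∈R dʰ
  toʰ (labSt {R = R} {Γ} {x = x} {y} ws ax p len uniq ws∉ d) =
    let h , dʰ = toʰ d in suc h , labSt ws ax p len uniq (All.map (∉labels⇒Fresh ((x , y) ∷ R) Γ) ws∉) dʰ
  toʰ (labSt₀ ax p d) = let h , dʰ = toʰ d in suc h , labSt₀ ax p dʰ
  toʰ (exch p q d) = let h , dʰ = toʰ d in h , exch p q dʰ

  fromʰ : ∀ {h R Γ} → LDerʰ M h R Γ → LDer M R Γ
  fromʰ id = id
  fromʰ (∨r d) = ∨r (fromʰ d)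
  fromʰ (∧r d e) = ∧r (fromʰ d) (fromʰ e)
  fromʰ (□r {R = R} {Γ} {x} {A = A} fresh d) = □r (Fresh⇒∉labels R ((x , □ A) ∷ Γ) fresh) (fromʰ d)
  fromʰ (◇r xy∈R d) = ◇r xy∈R (fromʰ d)
  fromʰ (labSt {R = R} {Γ} {x = x} {y} ws ax p len uniq fresh d) =
    labSt ws ax p len uniq (All.map (Fresh⇒∉labels ((x , y) ∷ R) Γ) fresh) (fromʰ d)
  fromʰ (labSt₀ ax p d) = labSt₀ ax p (fromʰ d)
  fromʰ (exch p q d) = exch p q (fromʰ d)

  relabel : ∀ {h R Γ} → LDerʰ M h R Γ → (σ : Label → Label) → ∀ {R'} → Maps σ R R'
          → LDerʰ M h R' (relabelΓ σ Γ)
  relabel id σ inc = id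
  relabel (∨r d) σ inc = ∨r (relabel d σ inc)
  relabel (∧r d e) σ inc = ∧r (relabel d σ inc) (relabel e σ inc)
  relabel (◇r xy∈R d) σ inc = ◇r (inc xy∈R) (relabel d σ inc)
  relabel (exch p q d) σ inc = exch ↭-refl (map⁺ _ q) (relabel d σ (λ uv∈ → inc (∈-resp-↭ p uv∈)))
  relabel (□r {R = R} {Γ} {x} {y} {A} (freshR , y≢x ∷ freshΓ) d) σ {R'} inc
    with y' , _ , fresh' ← freshFor [] R' (relabelΓ σ ((x , □ A) ∷ Γ)) =
    □r fresh' (subst (LDerʰ M _ _) relabel-premise (relabel d σ' inc'))
    where
    σ' = update y y' σ
    inc' : Maps σ' ((x , y) ∷ R) ((σ x , y') ∷ R')
    inc' (here refl) = here (cong₂ _,_ (update-other y' σ y≢x) (update-same y y' σ))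
    inc' (there uv∈) = there (Maps-updates (y ∷ []) (y' ∷ []) (freshR ∷ []) inc uv∈)
    relabel-premise : relabelΓ σ' ((y , A) ∷ Γ) ≡ (y' , A) ∷ relabelΓ σ Γ
    relabel-premise =
      cong₂ _∷_ (cong (_, A) (update-same y y' σ)) (relabelΓ-updates (y ∷ []) (y' ∷ []) (freshΓ ∷ []))
  relabel (labSt {R = R} {Γ} {x = x} {y} ws ax p len uniq fresh d) σ {R'} inc
    with ws' , len' , uniq' , ws'∉ ← freshDistinct _ (labels ((σ x , σ y) ∷ R') (relabelΓ σ Γ)) =
    labSt ws' ax (Path-map inc p) len' uniq' (All.map (∉labels⇒Fresh ((σ x , σ y) ∷ R') (relabelΓ σ Γ)) ws'∉)
      (subst (LDerʰ M _ _) (relabelΓ-updates ws ws' (All.map proj₂ fresh)) (relabel d σ' inc'))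
    where
    σ' = updates ws ws' σ
    ws≢x : All (_≢ x) ws
    ws≢x = All.map (λ f → proj₁ (All.head (proj₁ f))) fresh
    ws≢y : All (_≢ y) ws
    ws≢y = All.map (λ f → proj₂ (All.head (proj₁ f))) fresh
    chain-relabel : chain (σ' x) (map σ' ws) (σ' y) ≡ chain (σ x) ws' (σ y)
    chain-relabel =
      trans (cong₂ (λ x' ws'' → chain x' ws'' (σ' y)) (updates-other ws ws' σ ws≢x) (map-updates ws ws' σ uniq len len'))
            (cong (chain (σ x) ws') (updates-other ws ws' σ ws≢y))
    inc' : Maps σ' (chain x ws y ++ R) (chain (σ x) ws' (σ y) ++ R')
    inc' uv∈ with ∈-++⁻ (chain x ws y) uv∈
    ... | inj₁ uv∈chain = ∈-++⁺ˡ (subst (_ ∈_) chain-relabel (chain-map σ' x ws y uv∈chain))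
    ... | inj₂ uv∈R = ∈-++⁺ʳ _ (Maps-updates ws ws' (All.map (All.tail ∘ proj₁) fresh) inc uv∈R)
  relabel (labSt₀ {R = R} {Γ} {x = x} {y} ax p d) σ {R'} inc =
    labSt₀ ax (Path-map inc p) (subst (LDerʰ M _ _) (renΓ-relabel σ y x Γ) (relabel d σ' inc'))
    where
    σ' = λ z → ren (σ y) (σ x) (σ z)
    inc' : Maps σ' (renR y x R) (renR (σ y) (σ x) R')
    inc' uv∈ with (u , v) , uv∈R , refl ← ∈-map⁻ _ uv∈ =
      subst (_∈ renR (σ y) (σ x) R') (sym (cong₂ _,_ (ren-relabel σ y x u) (ren-relabel σ y x v)))
            (∈-map⁺ _ (inc uv∈R))

  mono-R : ∀ {h R R' Γ} → R ⊆ R' → LDerʰ M h R Γ → LDerʰ M h R' Γ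
  mono-R {Γ = Γ} R⊆R' d = subst (LDerʰ M _ _) (map-id Γ) (relabel d (λ z → z) R⊆R')

  rename-eigen : ∀ {h R Γ x y₀ y A} → FreshR y₀ R → FreshΓ y₀ Γ → y₀ ≢ x
               → LDerʰ M h ((x , y₀) ∷ R) ((y₀ , A) ∷ Γ) → LDerʰ M h ((x , y) ∷ R) ((y , A) ∷ Γ)
  rename-eigen {Γ = Γ} {x} {y₀} {y} {A} freshR freshΓ y₀≢x d =
    subst (LDerʰ M _ _) relabelled (relabel d (update y₀ y (λ z → z)) inc)
    where
    inc : Maps (update y₀ y (λ z → z)) ((x , y₀) ∷ _) ((x , y) ∷ _)
    inc (here refl) = here (cong₂ _,_ (update-other y _ y₀≢x) (update-same y₀ y _))
    inc (there uv∈) = there (Maps-updates (y₀ ∷ []) (y ∷ []) (freshR ∷ []) (λ uv∈' → uv∈') uv∈)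
    relabelled : relabelΓ (update y₀ y (λ z → z)) ((y₀ , A) ∷ Γ) ≡ (y , A) ∷ Γ
    relabelled = cong₂ _∷_ (cong (_, A) (update-same y₀ y _))
                           (trans (relabelΓ-updates (y₀ ∷ []) (y ∷ []) (freshΓ ∷ [])) (map-id Γ))

  id-∈ : ∀ {h R Γ z p} → (z , var p) ∈ Γ → (z , nvar p) ∈ Γ → LDerʰ M h R Γ
  id-∈ pos neg
    with Γ₁ , q ← ∈⇒↭ pos
    with Γ₂ , q' ← ∈⇒↭ (∈-↭-tail q neg λ ())
    = exchΓ (↭-sym (↭-trans q (prep _ q'))) id

  id-under : ∀ Φ {h R Γ z p x A Δ} → (z , var p) ∷ (z , nvar p) ∷ Γ ↭ (x , A) ∷ Δ
           → (z , var p) ≢ (x , A) → (z , nvar p) ≢ (x , A) → LDerʰ M h R (Φ ++ Δ)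
  id-under Φ q pos≢ neg≢ =
    id-∈ (∈-++⁺ʳ Φ (∈-↭-tail q (here refl) pos≢)) (∈-++⁺ʳ Φ (∈-↭-tail q (there (here refl)) neg≢))

  -- The non-principal cases of inversion and contraction: the last rule acts on a formula
  -- of Δ, underneath the prefix Φ produced by the transformation.
  rule-under : ∀ Φ Θ {h h' R R' a Δ Δ'} → Δ ↭ a ∷ Δ'
             → (LDerʰ M h R (Θ ++ Φ ++ Δ') → LDerʰ M h' R' (a ∷ Φ ++ Δ'))
             → LDerʰ M h R (Φ ++ Θ ++ Δ') → LDerʰ M h' R' (Φ ++ Δ)
  rule-under Φ Θ r rule d = exchΓ (↭-restore Φ r) (rule (exchΓ (shifts Φ Θ) d))

  rule₂-under : ∀ Φ Θ₁ Θ₂ {h h' R a Δ Δ'} → Δ ↭ a ∷ Δ'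
              → (LDerʰ M h R (Θ₁ ++ Φ ++ Δ') → LDerʰ M h R (Θ₂ ++ Φ ++ Δ') → LDerʰ M h' R (a ∷ Φ ++ Δ'))
              → LDerʰ M h R (Φ ++ Θ₁ ++ Δ') → LDerʰ M h R (Φ ++ Θ₂ ++ Δ') → LDerʰ M h' R (Φ ++ Δ)
  rule₂-under Φ Θ₁ Θ₂ r rule d e =
    exchΓ (↭-restore Φ r) (rule (exchΓ (shifts Φ Θ₁) d) (exchΓ (shifts Φ Θ₂) e))

  invert-∨ : ∀ {h R Γ x A B Δ} → LDerʰ M h R Γ → Γ ↭ (x , A ∨ B) ∷ Δ
           → LDerʰ M h R ((x , A) ∷ (x , B) ∷ Δ)
  invert-∨ id q = id-under (_ ∷ _ ∷ []) q (λ ()) (λ ())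
  invert-∨ (∨r d) q with ∷-↭-∷⁻ q
  ... | inj₁ (refl , q') = raise (n≤1+n _) (exchΓ (prep _ (prep _ q')) d)
  ... | inj₂ (_ , q' , r) =
    rule-under (_ ∷ _ ∷ []) (_ ∷ _ ∷ []) r ∨r (invert-∨ d (↭-under (_ ∷ _ ∷ []) (_ ∷ []) q'))
  invert-∨ (∧r d e) q with ∷-↭-∷⁻ q
  ... | inj₁ (() , _)
  ... | inj₂ (_ , q' , r) =
    rule₂-under (_ ∷ _ ∷ []) (_ ∷ []) (_ ∷ []) r ∧r
      (invert-∨ d (↭-under (_ ∷ []) (_ ∷ []) q')) (invert-∨ e (↭-under (_ ∷ []) (_ ∷ []) q'))
  invert-∨ (□r (freshR , y≢x ∷ freshΓ) d) q with ∷-↭-∷⁻ q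
  ... | inj₁ (() , _)
  ... | inj₂ (_ , q' , r) =
    rule-under (_ ∷ _ ∷ []) (_ ∷ []) r (□r (freshR , y≢x ∷ FreshΓ-∨ q' freshΓ))
      (invert-∨ d (↭-under (_ ∷ []) (_ ∷ []) q'))
  invert-∨ (◇r xy∈R d) q with ∷-↭-∷⁻ q
  ... | inj₁ (() , _)
  ... | inj₂ (_ , q' , r) =
    rule-under (_ ∷ _ ∷ []) (_ ∷ _ ∷ []) r (◇r xy∈R) (invert-∨ d (↭-under (_ ∷ _ ∷ []) (_ ∷ []) q'))
  invert-∨ (labSt ws ax p len uniq fresh d) q =
    labSt ws ax p len uniq (All.map (map₂ (FreshΓ-∨ q)) fresh) (invert-∨ d q)
  invert-∨ (labSt₀ ax p d) q = labSt₀ ax p (invert-∨ d (map⁺ _ q))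
  invert-∨ (exch p q' d) q = exch p ↭-refl (invert-∨ d (↭-trans q' q))

  invert-∧ : ∀ {h R Γ x A B Δ} → LDerʰ M h R Γ → Γ ↭ (x , A ∧ B) ∷ Δ
           → LDerʰ M h R ((x , A) ∷ Δ) × LDerʰ M h R ((x , B) ∷ Δ)
  invert-∧ id q = id-under (_ ∷ []) q (λ ()) (λ ()) , id-under (_ ∷ []) q (λ ()) (λ ())
  invert-∧ (∨r d) q with ∷-↭-∷⁻ q
  ... | inj₁ (() , _)
  ... | inj₂ (_ , q' , r) =
    let d₁ , d₂ = invert-∧ d (↭-under (_ ∷ _ ∷ []) (_ ∷ []) q')
    in rule-under (_ ∷ []) (_ ∷ _ ∷ []) r ∨r d₁ , rule-under (_ ∷ []) (_ ∷ _ ∷ []) r ∨r d₂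
  invert-∧ (∧r d e) q with ∷-↭-∷⁻ q
  ... | inj₁ (refl , q') = raise (n≤1+n _) (exchΓ (prep _ q') d) , raise (n≤1+n _) (exchΓ (prep _ q') e)
  ... | inj₂ (_ , q' , r) =
    let d₁ , d₂ = invert-∧ d (↭-under (_ ∷ []) (_ ∷ []) q')
        e₁ , e₂ = invert-∧ e (↭-under (_ ∷ []) (_ ∷ []) q')
    in rule₂-under (_ ∷ []) (_ ∷ []) (_ ∷ []) r ∧r d₁ e₁
     , rule₂-under (_ ∷ []) (_ ∷ []) (_ ∷ []) r ∧r d₂ e₂
  invert-∧ (□r (freshR , y≢x ∷ freshΓ) d) q with ∷-↭-∷⁻ q
  ... | inj₁ (() , _)
  ... | inj₂ (_ , q' , r) =
    let d₁ , d₂ = invert-∧ d (↭-under (_ ∷ []) (_ ∷ []) q')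
    in rule-under (_ ∷ []) (_ ∷ []) r (□r (freshR , y≢x ∷ FreshΓ-replace q' freshΓ)) d₁
     , rule-under (_ ∷ []) (_ ∷ []) r (□r (freshR , y≢x ∷ FreshΓ-replace q' freshΓ)) d₂
  invert-∧ (◇r xy∈R d) q with ∷-↭-∷⁻ q
  ... | inj₁ (() , _)
  ... | inj₂ (_ , q' , r) =
    let d₁ , d₂ = invert-∧ d (↭-under (_ ∷ _ ∷ []) (_ ∷ []) q')
    in rule-under (_ ∷ []) (_ ∷ _ ∷ []) r (◇r xy∈R) d₁ , rule-under (_ ∷ []) (_ ∷ _ ∷ []) r (◇r xy∈R) d₂
  invert-∧ (labSt ws ax p len uniq fresh d) q =
    let d₁ , d₂ = invert-∧ d q
    in labSt ws ax p len uniq (All.map (map₂ (FreshΓ-replace q)) fresh) d₁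
     , labSt ws ax p len uniq (All.map (map₂ (FreshΓ-replace q)) fresh) d₂
  invert-∧ (labSt₀ ax p d) q = let d₁ , d₂ = invert-∧ d (map⁺ _ q) in labSt₀ ax p d₁ , labSt₀ ax p d₂
  invert-∧ (exch p q' d) q = let d₁ , d₂ = invert-∧ d (↭-trans q' q) in exch p ↭-refl d₁ , exch p ↭-refl d₂

  -- The eigenvariable can be kept outside `avoid`, which the labSt₀ case needs: there it
  -- must differ from the label that gets identified with another one.
  invert-□ : ∀ (avoid : List Label) {h R Γ x A Δ} → LDerʰ M h R Γ → Γ ↭ (x , □ A) ∷ Δ
           → ∃ λ y → y ∉ avoid × Fresh y R Γ × LDerʰ M h ((x , y) ∷ R) ((y , A) ∷ Δ)
  invert-□ avoid {R = R} {Γ} id q =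
    let y , y∉ , fresh = freshFor avoid R Γ
    in y , y∉ , fresh , id-under (_ ∷ []) q (λ ()) (λ ())
  invert-□ avoid (∨r d) q with ∷-↭-∷⁻ q
  ... | inj₁ (() , _)
  ... | inj₂ (_ , q' , r)
    with y , y∉ , (freshR , y≢x₀ ∷ _ ∷ freshΓ) , e ← invert-□ avoid d (↭-under (_ ∷ _ ∷ []) (_ ∷ []) q')
    = y , y∉ , (freshR , y≢x₀ ∷ freshΓ) , rule-under (_ ∷ []) (_ ∷ _ ∷ []) r ∨r e
  invert-□ avoid (∧r d₁ d₂) q with ∷-↭-∷⁻ q
  ... | inj₁ (() , _)
  ... | inj₂ (_ , q' , r)
    with y , y∉ , (freshR , y≢x₀ ∷ freshΓ) , e₁ ← invert-□ avoid d₁ (↭-under (_ ∷ []) (_ ∷ []) q')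
    with y₂ , _ , (freshR₂ , y₂≢x₀ ∷ freshΓ₂) , e₂ ← invert-□ [] d₂ (↭-under (_ ∷ []) (_ ∷ []) q')
    = let y₂≢x , freshΔ₂ = FreshΓ-uncons q' freshΓ₂
      in y , y∉ , (freshR , y≢x₀ ∷ freshΓ) ,
         rule₂-under (_ ∷ []) (_ ∷ []) (_ ∷ []) r ∧r e₁ (rename-eigen freshR₂ (y₂≢x₀ ∷ freshΔ₂) y₂≢x e₂)
  invert-□ avoid {R = R} (□r {Γ = Γ₀} {x} {y₀} {A} (freshR₀ , y₀≢x ∷ freshΓ₀) d) q with ∷-↭-∷⁻ q
  ... | inj₁ (refl , q') =
    let y , y∉ , fresh = freshFor avoid R ((x , □ A) ∷ Γ₀)
    in y , y∉ , fresh , raise (n≤1+n _) (exchΓ (prep _ q') (rename-eigen freshR₀ freshΓ₀ y₀≢x d))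
  ... | inj₂ (_ , q' , r)
    with y , y∉ , ((y≢x₀ , y≢y₀) ∷ freshR , _ ∷ freshΓ) , e ← invert-□ avoid d (↭-under (_ ∷ []) (_ ∷ []) q')
    = y , y∉ , (freshR , y≢x₀ ∷ freshΓ) ,
      rule-under (_ ∷ []) (_ ∷ []) r (□r fresh') (exch (swap _ _ ↭-refl) ↭-refl e)
    where
    y₀≢y : y₀ ≢ y
    y₀≢y y₀≡y = y≢y₀ (sym y₀≡y)
    fresh' : Fresh y₀ ((_ , y) ∷ R) ((x , □ _) ∷ (y , _) ∷ _)
    fresh' = let y₀≢x' , freshΔ₀ = FreshΓ-uncons q' freshΓ₀
             in (y₀≢x' , y₀≢y) ∷ freshR₀ , y₀≢x ∷ y₀≢y ∷ freshΔ₀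
  invert-□ avoid (◇r xy∈R d) q with ∷-↭-∷⁻ q
  ... | inj₁ (() , _)
  ... | inj₂ (_ , q' , r)
    with y , y∉ , (freshR , _ ∷ freshΓ) , e ← invert-□ avoid d (↭-under (_ ∷ _ ∷ []) (_ ∷ []) q')
    = y , y∉ , (freshR , freshΓ) , rule-under (_ ∷ []) (_ ∷ _ ∷ []) r (◇r (there xy∈R)) e
  invert-□ avoid {R = R} {x = x} (labSt {x = z} {w} ws ax p len uniq freshWs d) q
    with y , y∉ , (freshR , freshΓ) , e ← invert-□ avoid d q
    = y , y∉ , (All-++⁻ʳ (chain z ws w) freshR , freshΓ) ,
      labSt ws ax (Path-weaken p) len uniq
        (All.zipWith extend (freshWs , FreshR-chain z ws w (All-++⁻ˡ (chain z ws w) freshR)))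
        (exch (↭-sym (shift _ (chain z ws w) R)) ↭-refl e)
    where
    extend : ∀ {v} → Fresh v ((z , w) ∷ R) _ × y ≢ v → Fresh v ((z , w) ∷ (x , y) ∷ R) ((y , _) ∷ _)
    extend ((v≢zw ∷ freshR' , freshΓ') , y≢v) =
      let v≢x , freshΔ = FreshΓ-uncons q freshΓ'
      in v≢zw ∷ (v≢x , λ v≡y → y≢v (sym v≡y)) ∷ freshR' , (λ v≡y → y≢v (sym v≡y)) ∷ freshΔ
  invert-□ avoid {R = R} {Γ} {x} {A} {Δ} (labSt₀ {h = h} {x = x₀} {y₀} ax p d) q
    with y , y∉ , (freshR , freshΓ) , e ← invert-□ (y₀ ∷ avoid) d (map⁺ _ q)
    = y , (λ y∈ → y∉ (there y∈)) ,
      (All.map (λ { (n₁ , n₂) → ≢-ren⁻ y≢y₀ n₁ , ≢-ren⁻ y≢y₀ n₂ }) (All-map⁻ freshR) ,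
       All.map (≢-ren⁻ y≢y₀) (All-map⁻ freshΓ)) ,
      labSt₀ ax (Path-weaken p)
        (subst (λ u → LDerʰ M h ((ren y₀ x₀ x , u) ∷ renR y₀ x₀ R) ((u , A) ∷ renΓ y₀ x₀ Δ))
               (sym (ren-other x₀ λ y₀≡y → y≢y₀ (sym y₀≡y))) e)
    where
    y≢y₀ : y ≢ y₀
    y≢y₀ y≡y₀ = y∉ (here y≡y₀)
  invert-□ avoid (exch p q' d) q
    with y , y∉ , (freshR , freshΓ) , e ← invert-□ avoid d (↭-trans q' q)
    = y , y∉ , (All-resp-↭ p freshR , All-resp-↭ q' freshΓ) , exch (prep _ p) ↭-refl e

  -- Induction on k > size C, then on the derivation; when C is principal the other copy is
  -- inverted and its immediate subformulas are contracted.
  contract : ∀ k {h R Γ x C Δ} → size C < k → LDerʰ M h R Γ → Γ ↭ (x , C) ∷ (x , C) ∷ Δ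
           → LDerʰ M h R ((x , C) ∷ Δ)
  contract zero () d q
  contract k lt id q = id-∈ (∈-dedup (∈-resp-↭ q (here refl))) (∈-dedup (∈-resp-↭ q (there (here refl))))
  contract (suc k) lt (∨r d) q with ∷-↭-∷∷⁻ q
  ... | inj₁ (refl , q') =
    let d' = invert-∨ d (↭-under (_ ∷ _ ∷ []) (_ ∷ []) q')
        dA = contract k (<-suc-+ˡ lt) d' (prep _ (swap _ _ ↭-refl))
        dB = contract k (<-suc-+ʳ lt) dA (↭-trans (swap _ _ ↭-refl) (prep _ (swap _ _ ↭-refl)))
    in ∨r (exchΓ (swap _ _ ↭-refl) dB)
  ... | inj₂ (_ , q' , r) =
    rule-under (_ ∷ []) (_ ∷ _ ∷ []) r ∨r (contract (suc k) lt d (↭-under (_ ∷ _ ∷ []) (_ ∷ _ ∷ []) q'))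
  contract (suc k) lt (∧r d e) q with ∷-↭-∷∷⁻ q
  ... | inj₁ (refl , q') =
    ∧r (contract k (<-suc-+ˡ lt) (proj₁ (invert-∧ d (↭-under (_ ∷ []) (_ ∷ []) q'))) ↭-refl)
       (contract k (<-suc-+ʳ lt) (proj₂ (invert-∧ e (↭-under (_ ∷ []) (_ ∷ []) q'))) ↭-refl)
  ... | inj₂ (_ , q' , r) =
    rule₂-under (_ ∷ []) (_ ∷ []) (_ ∷ []) r ∧r (contract (suc k) lt d (↭-under (_ ∷ []) (_ ∷ _ ∷ []) q'))
                                              (contract (suc k) lt e (↭-under (_ ∷ []) (_ ∷ _ ∷ []) q'))
  contract (suc k) lt (□r {y = y} (freshR , y≢x ∷ freshΓ) d) q with ∷-↭-∷∷⁻ q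
  ... | inj₁ (refl , q')
    with y₁ , _ , ((y₁≢x , y₁≢y) ∷ freshR₁ , _ ∷ freshΓ₁) , e ← invert-□ [] d (↭-under (_ ∷ []) (_ ∷ []) q')
    = let e' = rename-eigen {y = y} ((y₁≢x , y₁≢y) ∷ freshR₁) (y₁≢y ∷ proj₂ (FreshΓ-uncons q' freshΓ₁)) y₁≢x e
      in □r (freshR , y≢x ∷ proj₂ (FreshΓ-uncons q' freshΓ))
            (contract k (≤-pred lt) (mono-R ∈-dedup e') ↭-refl)
  ... | inj₂ (_ , q' , r) =
    rule-under (_ ∷ []) (_ ∷ []) r (□r (freshR , y≢x ∷ All.tail (All-resp-↭ q' freshΓ)))
      (contract (suc k) lt d (↭-under (_ ∷ []) (_ ∷ _ ∷ []) q'))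
  contract k lt (◇r xz∈R d) q with ∷-↭-∷∷⁻ q
  ... | inj₁ (refl , q') =
    ◇r xz∈R (exchΓ (swap _ _ ↭-refl) (contract k lt d (↭-under (_ ∷ []) (_ ∷ _ ∷ []) (prep _ q'))))
  ... | inj₂ (_ , q' , r) =
    rule-under (_ ∷ []) (_ ∷ _ ∷ []) r (◇r xz∈R) (contract k lt d (↭-under (_ ∷ _ ∷ []) (_ ∷ _ ∷ []) q'))
  contract k lt (labSt ws ax p len uniq fresh d) q =
    labSt ws ax p len uniq (All.map (map₂ (All.tail ∘ All-resp-↭ q)) fresh) (contract k lt d q)
  contract k lt (labSt₀ ax p d) q = labSt₀ ax p (contract k lt d (map⁺ _ q))
  contract k lt (exch p q' d) q = exch p ↭-refl (contract k lt d (↭-trans q' q))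

  contract-∈ : ∀ {R Γ a} → LDer M R (a ∷ Γ) → a ∈ Γ → LDer M R Γ
  contract-∈ {a = a} d a∈Γ =
    let _ , dʰ = toʰ d
        _ , q = ∈⇒↭ a∈Γ
    in fromʰ (exchΓ (↭-sym q) (contract (suc (size (proj₂ a))) ≤-refl dʰ (prep a q)))

-- Realisations of nested sequents

data Realisedᵢ (R : List Rel) (Γ : List LFm) : Label → Item → Set where
  fmᴿ : ∀ {x A} → (x , A) ∈ Γ → Realisedᵢ R Γ x (fm A)
  whᴿ : ∀ {x z Y} → (x , z) ∈ R → All (Realisedᵢ R Γ z) Y → Realisedᵢ R Γ x (wh Y)
  blᴿ : ∀ {x z Y} → (z , x) ∈ R → All (Realisedᵢ R Γ z) Y → Realisedᵢ R Γ x (bl Y)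

Realised : List Rel → List LFm → Label → NSeq → Set
Realised R Γ x = All (Realisedᵢ R Γ x)

module _ {R R' : List Rel} {Γ Γ' : List LFm} (σ : Label → Label) (inc : Maps σ R R')
         (incΓ : ∀ {a} → a ∈ Γ → (σ (proj₁ a) , proj₂ a) ∈ Γ') where

  mutual
    Realisedᵢ-map : ∀ {x i} → Realisedᵢ R Γ x i → Realisedᵢ R' Γ' (σ x) i
    Realisedᵢ-map (fmᴿ xA∈Γ) = fmᴿ (incΓ xA∈Γ)
    Realisedᵢ-map (whᴿ xz∈R rY) = whᴿ (inc xz∈R) (Realised-map rY)
    Realisedᵢ-map (blᴿ zx∈R rY) = blᴿ (inc zx∈R) (Realised-map rY)

    Realised-map : ∀ {x X} → Realised R Γ x X → Realised R' Γ' (σ x) X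
    Realised-map [] = []
    Realised-map (r ∷ rs) = Realisedᵢ-map r ∷ Realised-map rs

Realised-mono : ∀ {R R' Γ Γ' x X} → R ⊆ R' → Γ ⊆ Γ' → Realised R Γ x X → Realised R' Γ' x X
Realised-mono R⊆R' Γ⊆Γ' = Realised-map (λ z → z) R⊆R' Γ⊆Γ'

Realised-weakenΓ : ∀ {R Γ a x X} → Realised R Γ x X → Realised R (a ∷ Γ) x X
Realised-weakenΓ = Realised-mono (λ r∈ → r∈) there

Realised-nestW : ∀ n {R Γ x Y} → Realised R Γ x (nestW n Y) → ∃ λ y → Path R n x y × Realised R Γ y Y
Realised-nestW zero rY = _ , here , rY
Realised-nestW (suc n) (whᴿ xz∈R rN ∷ []) =
  let y , p , rY = Realised-nestW n rN in y , there xz∈R p , rY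

Realised-chain : ∀ {R Γ x y m} ws {Y} → Length ws m → chain x ws y ⊆ R → Realised R Γ y Y
               → Realised R Γ x (nestW (suc m) Y)
Realised-chain [] [] chain⊆R rY = whᴿ (chain⊆R (here refl)) rY ∷ []
Realised-chain (w ∷ ws) (_ ∷ len) chain⊆R rY =
  whᴿ (chain⊆R (here refl)) (Realised-chain ws len (λ r∈ → chain⊆R (there r∈)) rY) ∷ []

mutual
  trItem-realises : ∀ x k i → Realisedᵢ (LSeq.rels (trItem x k i)) (LSeq.fms (trItem x k i)) x i
  trItem-realises x k (fm A) = fmᴿ (here refl)
  trItem-realises x k (wh Y) with trSeq k (suc k) Y | trSeq-realises k (suc k) Y
  ... | ⟨ R , Γ , _ ⟩ | rY = whᴿ (here refl) (Realised-mono there (λ a∈ → a∈) rY)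
  trItem-realises x k (bl Y) with trSeq k (suc k) Y | trSeq-realises k (suc k) Y
  ... | ⟨ R , Γ , _ ⟩ | rY = blᴿ (here refl) (Realised-mono there (λ a∈ → a∈) rY)

  trSeq-realises : ∀ x k X → Realised (LSeq.rels (trSeq x k X)) (LSeq.fms (trSeq x k X)) x X
  trSeq-realises x k [] = []
  trSeq-realises x k (i ∷ X) with trItem x k i | trItem-realises x k i
  ... | ⟨ R₁ , Γ₁ , k₁ ⟩ | rᵢ with trSeq x k₁ X | trSeq-realises x k₁ X
  ...   | ⟨ R₂ , Γ₂ , _ ⟩ | rX =
    Realisedᵢ-map (λ z → z) ∈-++⁺ˡ ∈-++⁺ˡ rᵢ ∷ Realised-mono (∈-++⁺ʳ R₁) (∈-++⁺ʳ Γ₁) rX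

module _ {M : PathAxioms} where

  translate : ∀ {X} → NDer M X → ∀ {R Γ x} → Realised R Γ x X → LDer M R Γ
  translate id (fmᴿ pos ∷ fmᴿ neg ∷ _) = fromʰ (id-∈ {h = zero} pos neg)
  translate (∨r d) (fmᴿ x∨∈Γ ∷ rX) =
    contract-∈ (∨r (translate d
                   (fmᴿ (here refl) ∷ fmᴿ (there (here refl)) ∷ Realised-weakenΓ (Realised-weakenΓ rX))))
               x∨∈Γ
  translate (∧r d e) (fmᴿ x∧∈Γ ∷ rX) =
    contract-∈ (∧r (translate d (fmᴿ (here refl) ∷ Realised-weakenΓ rX))
                   (translate e (fmᴿ (here refl) ∷ Realised-weakenΓ rX)))
               x∧∈Γ
  translate (ctr {Y = Y} d) r with rY , rX ← All-++⁻ Y r = translate d (All-++⁺ rY (All-++⁺ rY rX))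
  translate (wk {Y = Y} d) r = translate d (All-++⁻ʳ Y r)
  translate (rf d) (blᴿ zx∈R rX ∷ rY) = translate d (whᴿ zx∈R rY ∷ rX)
  translate (rp d) (whᴿ xz∈R rX ∷ rY) = translate d (blᴿ xz∈R rY ∷ rX)
  translate (□r {A = A} d) {R} {Γ} {x} (fmᴿ x□∈Γ ∷ rX)
    with y , _ , (freshR , freshΓ) ← freshFor [] R Γ =
    contract-∈ (□r (Fresh⇒∉labels R ((x , □ A) ∷ Γ) (freshR , All.lookup freshΓ x□∈Γ ∷ freshΓ))
                   (translate d (whᴿ (here refl) (fmᴿ (here refl) ∷ []) ∷ Realised-mono there there rX)))
               x□∈Γ
  translate (◇r d) (whᴿ xz∈R rY ∷ fmᴿ x◇∈Γ ∷ rX) with _ , q ← ∈⇒↭ x◇∈Γ =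
    exch ↭-refl (↭-sym q) (◇r xz∈R (exch ↭-refl (prep _ q) (translate d
      (whᴿ xz∈R (fmᴿ (here refl) ∷ Realised-weakenΓ rY) ∷ fmᴿ (there x◇∈Γ) ∷ Realised-weakenΓ rX))))
  translate (nest {Y = Y} {n} {zero} ax d) {R} {Γ} {x} r
    with rN , rX ← All-++⁻ (nestW n Y) r
    with y , p , rY ← Realised-nestW n rN
    = labSt₀ ax p (translate d (All-++⁺ (collapse (ren-same y x) rY) (collapse (ren-target y x) rX)))
    where
    collapse : ∀ {z u Z} → ren y x z ≡ u → Realised R Γ z Z → Realised (renR y x R) (renΓ y x Γ) u Z
    collapse refl = Realised-map (ren y x) (∈-map⁺ _) (∈-map⁺ _)
  translate (nest {Y = Y} {n} {suc m} ax d) {R} {Γ} {x} r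
    with rN , rX ← All-++⁻ (nestW n Y) r
    with y , p , rY ← Realised-nestW n rN
    with ws , len , uniq , ws∉ ← freshDistinct m (x ∷ y ∷ labels R Γ)
    = labSt ws ax p len uniq ws∉ (translate d (All-++⁺ (Realised-chain ws len ∈-++⁺ˡ (weaken rY)) (weaken rX)))
    where
    weaken : ∀ {z Z} → Realised R Γ z Z → Realised (chain x ws y ++ R) Γ z Z
    weaken = Realised-mono (∈-++⁺ʳ _) (λ a∈ → a∈)
  translate (exch p d) r = translate d (All-resp-↭ (↭-sym p) r)

corollary4p5 : (M : PathAxioms) (X : NSeq) → NDer M X
             → LDer M (LSeq.rels (L X)) (LSeq.fms (L X))
corollary4p5 M X d = translate d (trSeq-realises 0 1 X)
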